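{- Let $\vec G$ be any feasible PV graph with $k$ carriers and system period $p$, and suppose the agent is given an integer $B\ge p$. Then the number of moves performed by Algorithm Hitch-a-ride to explore $\vec G$ is at most $(3k-2)B'$, where $B'=B$ if the set of routes is known to the agent to be homogeneous and $B'=B^2$ otherwise.
   Context: A PV system consists of a finite set $S$ of $n$ sites and a set $C$ of $k$ carriers; each carrier $c$ has a unique identifier and a route $\pi(c)=\langle x_0,\dots,x_{p(c)-1}\rangle$ of sites, with period $p(c)$ and $\pi(c)[j]=x_{j\bmod p(c)}$; at each time $t=0,1,\dots$ carrier $c$ moves from $\pi(c)[t]$ to $\pi(c)[t+1]$. The system period is $p=\max_c p(c)$; the system is homogeneous if all periods are equal. Carriers $a,b$ meet at site $z$ at time $t$ if $\pi(a)[t]=\pi(b)[t]=z$. An exploring agent is placed at time $0$ at a starting site $x\in\{\pi(c)[0]\}$; at each time $t$, at site $y$, it observes the identifiers of carriers $c$ with $\pi(c)[t]=y$ and either halts or moves with one such carrier to $\pi(c)[t+1]$ (one move); "riding with $c$" means repeatedly choosing $c$, and the agent may switch from $c$ to $c'$ at a time when they meet. The PV graph is feasible if from every starting site some finite sequence of moves visits all sites. Algorithm Hitch-a-ride: with $B'$ as in the claim, the agent starts riding with a carrier $c_0$ present at its start site (the Home, with no parent), keeps a set Visited of carriers (initially empty) and a set Encounters of carriers seen but not yet visited (initially $\{c_0\}$), and performs a depth-first (pre-order) traversal of the carriers. When riding with a carrier $c\notin$ Visited, it visits $c$: it sets $N(c)=\{\mathrm{parent}(c)\}$ and rides with $c$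 for $B'$ time units, adding every carrier met during this ride that is neither visited nor in Encounters to Encounters and to $N(c)$; then it adds $c$ to Visited and removes $c$ from Encounters. Next, if $N(c)\cap$ Encounters $\neq\emptyset$, it keeps riding with $c$ until it meets some $c'\in N(c)\cap$ Encounters, sets $\mathrm{parent}(c')=c$, switches to $c'$ and continues with $c'$. Otherwise, if $c$ is the Home (and Encounters is empty) it halts; else it keeps riding with $c$ until it meets $\mathrm{parent}(c)$, switches to it and continues with it (visiting only carriers not yet in Visited). -}

module Defs where

open import Data.Nat using (ℕ; zero; suc; _*_; _≤_; _⊔_; NonZero)
open import Data.Nat.DivMod using (_mod_)
open import Data.Fin using (Fin; _≟_)
open import Data.Fin.Subset using (Subset; _∪_; _∩_; ⁅_⁆; ⊥; _∈_; Empty; Nonempty; outside)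
open import Data.Bool using (Bool; true; false; _∧_; not)
open import Data.Maybe using (Maybe; just; nothing)
open import Data.List using (List; []; _∷_; [_]; foldr; map; allFin)
open import Data.List.Membership.Propositional using () renaming (_∈_ to _∈ˡ_)
open import Data.Vec using (tabulate; lookup; _[_]≔_)
open import Data.Product using (_×_; ∃)
open import Data.Unit using (⊤)
open import Relation.Nullary using (¬_)
open import Relation.Nullary.Decidable using (⌊_⌋)
open import Relation.Binary.PropositionalEquality using (_≡_; _≢_)

record PVGraph (n k : ℕ) : Set where
  field
    period   : Fin k → ℕ
    period≢0 : (c : Fin k) → NonZero (period c)
    route    : (c : Fin k) → Fin (period c) → Fin n

open PVGraph public

π : ∀ {n k} → PVGraph n k → Fin k → ℕ → Fin n
π G c t = route G c (_mod_ t (period G c) {{period≢0 G c}})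

systemPeriod : ∀ {n k} → PVGraph n k → ℕ
systemPeriod {k = k} G = foldr _⊔_ 0 (map (period G) (allFin k))

Homogeneous : ∀ {n k} → PVGraph n k → Set
Homogeneous G = ∀ a b → period G a ≡ period G b

ValidMoves : ∀ {n k} → PVGraph n k → ℕ → Fin n → List (Fin k) → Set
ValidMoves G t y []       = ⊤
ValidMoves G t y (c ∷ cs) = π G c t ≡ y × ValidMoves G (suc t) (π G c (suc t)) cs

sitesVisited : ∀ {n k} → PVGraph n k → ℕ → Fin n → List (Fin k) → List (Fin n)
sitesVisited G t y []       = [ y ]
sitesVisited G t y (c ∷ cs) = y ∷ sitesVisited G (suc t) (π G c (suc t)) cs

Feasible : ∀ {n k} → PVGraph n k → Set
Feasible {n} {k} G =
  (c : Fin k) → ∃ λ (cs : List (Fin k)) →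
    ValidMoves G 0 (π G c 0) cs × ((z : Fin n) → z ∈ˡ sitesVisited G 0 (π G c 0) cs)

-- Algorithm Hitch-a-ride, as a (nondeterministic) small-step transition
-- system.  The agent always rides with the carrier `cur`; every
-- transition that advances time is exactly one move.

data Phase : Set where
  visiting : ℕ → Phase   -- visiting cur, with this many ride units remaining
  seeking  : Phase       -- cur visited; looking for a child in N(cur) ∩ Enc, or for the parent
  halted   : Phase

record State (k : ℕ) : Set where
  field
    time     : ℕ
    moves    : ℕ
    cur      : Fin k
    phase    : Phase
    visited  : Subset k
    enc      : Subset k
    nbr      : Fin k → Subset k
    parent   : Fin k → Maybe (Fin k)

open State public

override : ∀ {k} {A : Set} → (Fin k → A) → Fin k → A → Fin k → A
override f c a d with ⌊ d ≟ c ⌋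
... | true  = a
... | false = f d

newlyMet : ∀ {n k} → PVGraph n k → State k → Subset k
newlyMet G s = tabulate λ d →
  ⌊ π G d (time s) ≟ π G (cur s) (time s) ⌋ ∧ not (lookup (visited s) d) ∧ not (lookup (enc s) d)

advance : ∀ {k} → State k → State k
advance s = record s { time = suc (time s) ; moves = suc (moves s) }

data Step {n k : ℕ} (G : PVGraph n k) (B' : ℕ) (home : Fin k) : State k → State k → Set where
  visit-ride : ∀ {s r} → phase s ≡ visiting (suc r) →
    Step G B' home s
      (record (advance s)
        { phase = visiting r
        ; enc   = enc s ∪ newlyMet G s
        ; nbr   = override (nbr s) (cur s) (nbr s (cur s) ∪ newlyMet G s) })
  visit-end : ∀ {s} → phase s ≡ visiting 0 →
    Step G B' home s
      (record s
        { phase   = seeking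
        ; visited = visited s ∪ ⁅ cur s ⁆
        ; enc     = enc s [ cur s ]≔ outside })
  to-child : ∀ {s} c' → phase s ≡ seeking → c' ∈ (nbr s (cur s) ∩ enc s) →
    π G c' (time s) ≡ π G (cur s) (time s) →
    Step G B' home s
      (record s
        { cur    = c'
        ; phase  = visiting B'
        ; parent = override (parent s) c' (just (cur s))
        ; nbr    = override (nbr s) c' ⁅ cur s ⁆ })
  wait-child : ∀ {s} → phase s ≡ seeking → Nonempty (nbr s (cur s) ∩ enc s) →
    (∀ c' → c' ∈ (nbr s (cur s) ∩ enc s) → π G c' (time s) ≢ π G (cur s) (time s)) →
    Step G B' home s (advance s)
  halt : ∀ {s} → phase s ≡ seeking → Empty (nbr s (cur s) ∩ enc s) → cur s ≡ home →
    Step G B' home s (record s { phase = halted })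
  to-parent : ∀ {s} q → phase s ≡ seeking → Empty (nbr s (cur s) ∩ enc s) → cur s ≢ home →
    parent s (cur s) ≡ just q → π G q (time s) ≡ π G (cur s) (time s) →
    Step G B' home s (record s { cur = q })
  wait-parent : ∀ {s} q → phase s ≡ seeking → Empty (nbr s (cur s) ∩ enc s) → cur s ≢ home →
    parent s (cur s) ≡ just q → π G q (time s) ≢ π G (cur s) (time s) →
    Step G B' home s (advance s)

initial : ∀ {k} → ℕ → Fin k → State k
initial B' c₀ = record
  { time = 0 ; moves = 0 ; cur = c₀ ; phase = visiting B'
  ; visited = ⊥ ; enc = ⁅ c₀ ⁆ ; nbr = λ _ → ⊥ ; parent = λ _ → nothing }

-- Every run from s halts (finitely), never gets stuck, and at halting the
-- number of moves performed is at most `bound`.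
data HaltsWithin {n k : ℕ} (G : PVGraph n k) (B' : ℕ) (home : Fin k) (bound : ℕ)
       : State k → Set where
  stop : ∀ {s} → phase s ≡ halted → moves s ≤ bound → HaltsWithin G B' home bound s
  go   : ∀ {s} → phase s ≢ halted → ∃ (λ s' → Step G B' home s s') →
         (∀ s' → Step G B' home s s' → HaltsWithin G B' home bound s') →
         HaltsWithin G B' home bound s

B′ : Bool → ℕ → ℕ
B′ true  B = B
B′ false B = B * B

module Submission where

-- Two carriers that meet once meet again in every window of B′ consecutive time units,
-- because B′ is at least a common multiple of their periods: the common period when the
-- routes are homogeneous, the product of the two periods otherwise.  So every wait of the
-- agent, for a child to board or for the parent to return to, is shorter than B′, and each
-- carrier other than the Home costs at most 3B′ − 2 moves: B′ riding it, and fewer than B′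
-- each for boarding it and for getting back to its parent.  With B′ for the Home this is
-- at most (3k − 2)B′.  Formally, a credit bounding the remaining moves drops by one with
-- every move, and a rank drops on the transitions that take no time.

open import Data.Bool using (Bool; true; false; T; _∧_; not)
open import Data.Bool.Properties using (T-∧; T-≡)
open import Data.Empty using (⊥-elim)
open import Data.Fin using (Fin; zero; suc; _≟_)
open import Data.Fin.Properties using (any?; fromℕ<-cong; nonZeroIndex)
open import Data.Fin.Subset
  using (Subset; _∪_; _∩_; ⁅_⁆; _∈_; _∉_; _⊆_; ∣_∣; ∁; Empty; Nonempty; outside; inside)
  renaming (⊥ to ∅)
open import Data.Fin.Subset.Properties
  using (_∈?_; nonempty?; ∉⊥; x∈⁅x⁆; x∈⁅y⁆⇒x≡y; x∈p∩q⁻; x∈p∪q⁻; x∈p∪q⁺; ∪-identityʳ; p⊆p∪q; drop-not-there)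
open import Data.List using (List; _∷_; foldr)
open import Data.List.Membership.Propositional using () renaming (_∈_ to _∈ˡ_)
open import Data.List.Membership.Propositional.Properties using (∈-map⁺; ∈-allFin)
open import Data.List.Relation.Unary.Any as Any using ()
open import Data.Maybe using (Maybe; just)
open import Data.Maybe.Properties using (just-injective)
open import Data.Nat using (ℕ; zero; suc; pred; _+_; _*_; _∸_; _≤_; _<_; _⊔_; NonZero; z≤n; s≤s⁻¹)
open import Data.Nat.Divisibility using (_∣_; ∣-refl; ∣-reflexive; m∣m*n; n∣m*n)
open import Data.Nat.DivMod using (_%_; %-distribˡ-+; m%n%n≡m%n; [m+kn]%n≡m%n; m%n<n; m∣n⇒o%n%m≡o%m)
open import Data.Nat.Properties hiding (_≟_)
open import Data.Nat.Tactic.RingSolver using (solve-∀)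
open import Data.Product using (_×_; ∃; ∃₂; Σ; _,_; proj₁; proj₂)
open import Data.Sum using (_⊎_; inj₁; inj₂)
open import Data.Vec using (_∷_; lookup; _[_]≔_; here; there)
open import Data.Vec.Properties using ([]=⇒lookup; lookup∘tabulate)
open import Function.Bundles using (module Equivalence)
open import Relation.Nullary using (¬_; yes; no)
open import Relation.Nullary.Decidable using (⌊_⌋; _×-dec_; toWitness)
open import Relation.Binary.PropositionalEquality

open import Defs

open Equivalence using (to; from)
open ≡-Reasoning

∣∁⊥∣≡n : ∀ n → ∣ ∁ (∅ {n}) ∣ ≡ n
∣∁⊥∣≡n zero = refl
∣∁⊥∣≡n (suc n) = cong suc (∣∁⊥∣≡n n)

x∉p⇒∣∁p∣≡1+∣∁[p∪⁅x⁆]∣ : ∀ {n} (p : Subset n) {x} → x ∉ p → ∣ ∁ p ∣ ≡ suc ∣ ∁ (p ∪ ⁅ x ⁆) ∣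
x∉p⇒∣∁p∣≡1+∣∁[p∪⁅x⁆]∣ (inside ∷ p) {zero} x∉p = ⊥-elim (x∉p here)
x∉p⇒∣∁p∣≡1+∣∁[p∪⁅x⁆]∣ (outside ∷ p) {zero} x∉p = cong (λ q → suc ∣ ∁ q ∣) (sym (∪-identityʳ p))
x∉p⇒∣∁p∣≡1+∣∁[p∪⁅x⁆]∣ (inside ∷ p) {suc x} x∉p = x∉p⇒∣∁p∣≡1+∣∁[p∪⁅x⁆]∣ p (drop-not-there x∉p)
x∉p⇒∣∁p∣≡1+∣∁[p∪⁅x⁆]∣ (outside ∷ p) {suc x} x∉p = cong suc (x∉p⇒∣∁p∣≡1+∣∁[p∪⁅x⁆]∣ p (drop-not-there x∉p))

x∈p[y]≔outside⁻ : ∀ {n} (p : Subset n) {x} y → x ∈ p [ y ]≔ outside → x ≢ y × x ∈ p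
x∈p[y]≔outside⁻ (b ∷ p) zero (there x∈p) = (λ ()) , there x∈p
x∈p[y]≔outside⁻ (b ∷ p) (suc y) here = (λ ()) , here
x∈p[y]≔outside⁻ (b ∷ p) (suc y) (there x∈p) with x∈p[y]≔outside⁻ p y x∈p
... | x≢y , x∈p' = (λ { refl → x≢y refl }) , there x∈p'

override-≡ : ∀ {k} {A : Set} (f : Fin k → A) c a → override f c a c ≡ a
override-≡ f c a with c ≟ c
... | yes _ = refl
... | no c≢c = ⊥-elim (c≢c refl)

override-≢ : ∀ {k} {A : Set} (f : Fin k → A) c a {d} → d ≢ c → override f c a d ≡ f d
override-≢ f c a {d} d≢c with d ≟ c
... | yes d≡c = ⊥-elim (d≢c d≡c)
... | no _ = refl

∈-override⁻ : ∀ {k m} (f : Fin k → Subset m) c p d {x} → x ∈ override f c p d → (d ≡ c × x ∈ p) ⊎ x ∈ f d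
∈-override⁻ f c p d x∈ with d ≟ c
... | yes d≡c = inj₁ (d≡c , x∈)
... | no _ = inj₂ x∈

≤-foldr-⊔ : ∀ {x} (xs : List ℕ) → x ∈ˡ xs → x ≤ foldr _⊔_ 0 xs
≤-foldr-⊔ (y ∷ ys) (Any.here refl) = m≤m⊔n y _
≤-foldr-⊔ (y ∷ ys) (Any.there x∈ys) = ≤-trans (≤-foldr-⊔ ys x∈ys) (m≤n⊔m y _)

[m%d+n]%d≡[m+n]%d : ∀ m n d .{{_ : NonZero d}} → (m % d + n) % d ≡ (m + n) % d
[m%d+n]%d≡[m+n]%d m n d = begin
  (m % d + n) % d         ≡⟨ %-distribˡ-+ (m % d) n d ⟩
  (m % d % d + n % d) % d ≡⟨ cong (λ z → (z + n % d) % d) (m%n%n≡m%n m d) ⟩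
  (m % d + n % d) % d     ≡⟨ %-distribˡ-+ m n d ⟨
  (m + n) % d             ∎

reach-residue : ∀ t T P .{{_ : NonZero P}} → ∃ λ δ → δ < P × (δ + T) % P ≡ t % P
reach-residue t T P@(suc q) = (t + T * q) % P , m%n<n (t + T * q) P , (begin
  ((t + T * q) % P + T) % P ≡⟨ [m%d+n]%d≡[m+n]%d (t + T * q) T P ⟩
  (t + T * q + T) % P       ≡⟨ cong (_% P) (rearrange t T q) ⟩
  (t + T * P) % P           ≡⟨ [m+kn]%n≡m%n t T P ⟩
  t % P                     ∎)
  where
  rearrange : ∀ t T q → t + T * q + T ≡ t + T * suc q
  rearrange = solve-∀

module _ {n k : ℕ} (G : PVGraph n k) where

  MeetAt : Fin k → Fin k → ℕ → Set
  MeetAt x y t = π G x t ≡ π G y t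

  Meets : Fin k → Fin k → Set
  Meets x y = ∃ (MeetAt x y)

  RecurringMeetings : ℕ → Set
  RecurringMeetings w = ∀ x y → Meets x y → ∀ T → ∃ λ δ → δ < w × MeetAt x y (δ + T)

  π-cong-% : ∀ c P .{{_ : NonZero P}} → period G c ∣ P → ∀ {t t'} → t % P ≡ t' % P → π G c t ≡ π G c t'
  π-cong-% c P p∣P {t} {t'} eq = cong (route G c) (fromℕ<-cong _ _ t%p≡t'%p _ _)
    where
    instance _ = period≢0 G c
    p = period G c
    t%p≡t'%p : t % p ≡ t' % p
    t%p≡t'%p = begin
      t % p      ≡⟨ m∣n⇒o%n%m≡o%m p P t p∣P ⟨
      t % P % p  ≡⟨ cong (_% p) eq ⟩
      t' % P % p ≡⟨ m∣n⇒o%n%m≡o%m p P t' p∣P ⟩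
      t' % p     ∎

  meets-recur : ∀ {x y} P .{{_ : NonZero P}} → period G x ∣ P → period G y ∣ P →
                Meets x y → ∀ T → ∃ λ δ → δ < P × MeetAt x y (δ + T)
  meets-recur {x} {y} P px∣P py∣P (t , meet) T with reach-residue t T P
  ... | δ , δ<P , eq = δ , δ<P , (begin
    π G x (δ + T) ≡⟨ π-cong-% x P px∣P eq ⟩
    π G x t       ≡⟨ meet ⟩
    π G y t       ≡⟨ π-cong-% y P py∣P eq ⟨
    π G y (δ + T) ∎)

  period≤systemPeriod : ∀ c → period G c ≤ systemPeriod G
  period≤systemPeriod c = ≤-foldr-⊔ _ (∈-map⁺ (period G) (∈-allFin c))

  recurringMeetings-B′ : ∀ B kh → systemPeriod G ≤ B → (kh ≡ true → Homogeneous G) →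
                         RecurringMeetings (B′ kh B)
  recurringMeetings-B′ B true p≤B hom x y mt T
    with meets-recur (period G x) {{period≢0 G x}} ∣-refl (∣-reflexive (hom refl y x)) mt T
  ... | δ , δ<px , meet = δ , <-≤-trans δ<px (≤-trans (period≤systemPeriod x) p≤B) , meet
  recurringMeetings-B′ B false p≤B hom x y mt T
    with meets-recur (period G x * period G y) {{m*n≢0 _ _ {{period≢0 G x}} {{period≢0 G y}}}}
                     (m∣m*n (period G y)) (n∣m*n (period G x)) mt T
  ... | δ , δ<pxpy , meet = δ , <-≤-trans δ<pxpy (*-mono-≤ (p≤B' x) (p≤B' y)) , meet
    where
    p≤B' : ∀ c → period G c ≤ B
    p≤B' c = ≤-trans (period≤systemPeriod c) p≤B

  HaltedWithin : ℕ → State k → Set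
  HaltedWithin bound s = phase s ≡ halted × moves s ≤ bound

  haltsWithin-byMeasure : ∀ {B′ home bound} (Inv : State k → Set) (μ : ∀ {s} → Inv s → ℕ) →
    (∀ {s} → Inv s → phase s ≢ halted) →
    (∀ {s} → Inv s → ∃ (Step G B′ home s)) →
    (∀ {s s'} (i : Inv s) → Step G B′ home s s' → HaltedWithin bound s' ⊎ Σ (Inv s') λ i' → μ i' < μ i) →
    ∀ {s} → Inv s → HaltsWithin G B′ home bound s
  haltsWithin-byMeasure {B′} {home} {bound} Inv μ live progress preserve i = run (suc (μ i)) i ≤-refl
    where
    run : ∀ N {s} (i : Inv s) → μ i < N → HaltsWithin G B′ home bound s
    run (suc N) i μ<N = go (live i) (progress i) λ s' step → continue (preserve i step)
      where
      continue : ∀ {s'} → HaltedWithin bound s' ⊎ Σ (Inv s') (λ i' → μ i' < μ i) →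
                 HaltsWithin G B′ home bound s'
      continue (inj₁ (isHalted , within)) = stop isHalted within
      continue (inj₂ (i' , μ'<μ)) = run N i' (<-≤-trans μ'<μ (s≤s⁻¹ μ<N))

  -- The window is written suc b, so that b = B′ − 1 bounds every wait for a meeting.
  module HitchARide (b : ℕ) (recur : RecurringMeetings (suc b)) (home : Fin k) where

    bound : ℕ
    bound = (3 * k ∸ 2) * suc b

    pending : State k → Subset k
    pending s = nbr s (cur s) ∩ enc s

    unvisited : State k → ℕ
    unvisited s = ∣ ∁ (visited s) ∣

    perCarrier : ℕ
    perCarrier = suc (3 * b)

    data PathHome (par : Fin k → Maybe (Fin k)) (V : Subset k) : Fin k → ℕ → Set where
      root      : ∀ {x} → x ≡ home → PathHome par V x 0
      viaParent : ∀ {x y d} → par x ≡ just y → y ∈ V → Meets x y → PathHome par V y d →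
                  PathHome par V x (suc d)

    record Coherent (s : State k) (d : ℕ) : Set where
      constructor coherent
      field
        pathHome     : PathHome (parent s) (visited s) (cur s) d
        encUnvisited : ∀ x → x ∈ enc s → x ∉ visited s
        nbrMeet      : ∀ c x → x ∈ nbr s c → Meets c x
    open Coherent

    -- Potential s d ph C S: at depth d of the parent path, the credit C bounds the moves still
    -- to come (perCarrier = 3B′ − 2 per unvisited carrier, b per level to climb back home, and
    -- the δ time units until the awaited meeting); the rank S drops on the timeless transitions.
    data Potential (s : State k) : ℕ → Phase → ℕ → ℕ → Set where
      riding      : ∀ {d} r u → cur s ∉ visited s → unvisited s ≡ suc u →
                    Potential s d (visiting r) (r + perCarrier * u + b * d) (suc (4 * u + 2 * d))
      childAhead  : ∀ {d} u δ c' → cur s ∈ visited s → c' ∈ pending s → MeetAt c' (cur s) (δ + time s) →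
                    unvisited s ≡ suc u →
                    Potential s d seeking (δ + (suc b + perCarrier * u + b * suc d)) (4 * suc u + 2 * d)
      doneAtHome  : Empty (pending s) → Potential s 0 seeking 0 (4 * unvisited s)
      parentAhead : ∀ d δ y → Empty (pending s) → parent s (cur s) ≡ just y → MeetAt y (cur s) (δ + time s) →
                    Potential s (suc d) seeking (δ + (perCarrier * unvisited s + b * d))
                                                (4 * unvisited s + 2 * suc d)

    toPhase : ∀ {s d ph C S} → phase s ≡ ph → Potential s d (phase s) C S → Potential s d ph C S
    toPhase {s} {d} {C = C} {S} eq = subst (λ ph → Potential s d ph C S) eq

    fromPhase : ∀ {s d ph C S} → phase s ≡ ph → Potential s d ph C S → Potential s d (phase s) C S
    fromPhase {s} {d} {C = C} {S} eq = subst (λ ph → Potential s d ph C S) (sym eq)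

    record Invariant (s : State k) : Set where
      constructor invariant
      field
        {depth credit rank} : ℕ
        coh          : Coherent s depth
        potential    : Potential s depth (phase s) credit rank
        withinBudget : moves s + credit ≤ bound

    measure : ∀ {s} → Invariant s → ℕ
    measure i = Invariant.credit i + Invariant.rank i

    childCredit≤ : ∀ {δ} u d → δ < suc b → δ + (suc b + perCarrier * u + b * suc d) ≤ perCarrier * suc u + b * d
    childCredit≤ {δ} u d δ<1+b = ≤-trans (+-monoˡ-≤ _ (s≤s⁻¹ δ<1+b)) (≤-reflexive (eq b u d))
      where
      eq : ∀ b u d → b + (suc b + suc (3 * b) * u + b * suc d) ≡ suc (3 * b) * suc u + b * d
      eq = solve-∀

    parentCredit≤ : ∀ {δ} U d → δ < suc b → δ + (perCarrier * U + b * d) ≤ perCarrier * U + b * suc d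
    parentCredit≤ {δ} U d δ<1+b = ≤-trans (+-monoˡ-≤ _ (s≤s⁻¹ δ<1+b)) (≤-reflexive (eq b U d))
      where
      eq : ∀ b U d → b + (suc (3 * b) * U + b * d) ≡ suc (3 * b) * U + b * suc d
      eq = solve-∀

    seekingPotential : ∀ {s d} → cur s ∈ visited s → Coherent s d →
      ∃₂ λ C S → Potential s d seeking C S × C ≤ perCarrier * unvisited s + b * d × S ≡ 4 * unvisited s + 2 * d
    seekingPotential {s} {d} cV coh with nonempty? (pending s)
    ... | yes (c' , c'∈) with x∈p∩q⁻ (nbr s (cur s)) (enc s) c'∈
    ...   | c'∈N , c'∈E with recur (cur s) c' (nbrMeet coh _ _ c'∈N) (time s)
                            | x∉p⇒∣∁p∣≡1+∣∁[p∪⁅x⁆]∣ (visited s) (encUnvisited coh c' c'∈E)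
    ...     | δ , δ<1+b , meet | eqU rewrite eqU =
              _ , _ , childAhead _ δ c' cV c'∈ (sym meet) eqU , childCredit≤ _ d δ<1+b , refl
    seekingPotential {s} {d} cV coh | no none with pathHome coh
    ... | root _ = _ , _ , doneAtHome none , z≤n , sym (+-identityʳ _)
    ... | viaParent {y = y} {d = d'} py _ mt _ with recur (cur s) y mt (time s)
    ...   | δ , δ<1+b , meet = _ , _ , parentAhead d' δ y none py (sym meet) , parentCredit≤ _ d' δ<1+b , refl

    ∈-newlyMet⁻ : ∀ {s x} → x ∈ newlyMet G s → MeetAt x (cur s) (time s) × x ∉ visited s
    ∈-newlyMet⁻ {s} {x} x∈ = toWitness met , λ x∈V → subst (λ v → T (not v)) ([]=⇒lookup x∈V) unseen
      where
      met? = π G x (time s) ≟ π G (cur s) (time s)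
      entry : T (⌊ met? ⌋ ∧ not (lookup (visited s) x) ∧ not (lookup (enc s) x))
      entry = T-≡ .from (trans (sym (lookup∘tabulate _ x)) ([]=⇒lookup x∈))
      met = proj₁ (T-∧ {⌊ met? ⌋} .to entry)
      unseen = proj₁ (T-∧ {not (lookup (visited s) x)} .to (proj₂ (T-∧ {⌊ met? ⌋} .to entry)))

    pathHome-mono : ∀ {par V V' x d} → V ⊆ V' → PathHome par V x d → PathHome par V' x d
    pathHome-mono V⊆V' (root atHome) = root atHome
    pathHome-mono V⊆V' (viaParent px yV mt path) = viaParent px (V⊆V' yV) mt (pathHome-mono V⊆V' path)

    pathHome-override : ∀ {par V c v x d} → c ∉ V → x ≢ c → PathHome par V x d → PathHome (override par c v) V x d
    pathHome-override c∉V x≢c (root atHome) = root atHome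
    pathHome-override {par} {V} {c} {v} c∉V x≢c (viaParent px yV mt path) =
      viaParent (trans (override-≢ par c v x≢c) px) yV mt (pathHome-override c∉V (λ { refl → c∉V yV }) path)

    encUnvisited-ride : ∀ {s d} → Coherent s d → ∀ x → x ∈ enc s ∪ newlyMet G s → x ∉ visited s
    encUnvisited-ride {s} coh x x∈ with x∈p∪q⁻ (enc s) (newlyMet G s) x∈
    ... | inj₁ x∈E = encUnvisited coh x x∈E
    ... | inj₂ x∈M = proj₂ (∈-newlyMet⁻ {s} x∈M)

    nbrMeet-ride : ∀ {s d} → Coherent s d →
      ∀ c x → x ∈ override (nbr s) (cur s) (nbr s (cur s) ∪ newlyMet G s) c → Meets c x
    nbrMeet-ride {s} coh c x x∈ with ∈-override⁻ (nbr s) (cur s) (nbr s (cur s) ∪ newlyMet G s) c x∈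
    ... | inj₂ x∈N = nbrMeet coh c x x∈N
    ... | inj₁ (refl , x∈') with x∈p∪q⁻ (nbr s (cur s)) (newlyMet G s) x∈'
    ...   | inj₁ x∈N = nbrMeet coh c x x∈N
    ...   | inj₂ x∈M = time s , sym (proj₁ (∈-newlyMet⁻ {s} x∈M))

    encUnvisited-visitEnd : ∀ {s d} → Coherent s d →
      ∀ x → x ∈ enc s [ cur s ]≔ outside → x ∉ visited s ∪ ⁅ cur s ⁆
    encUnvisited-visitEnd {s} coh x x∈ x∈V' with x∈p[y]≔outside⁻ (enc s) (cur s) x∈
    ... | x≢c , x∈E with x∈p∪q⁻ (visited s) ⁅ cur s ⁆ x∈V'
    ...   | inj₁ x∈V = encUnvisited coh x x∈E x∈V
    ...   | inj₂ x∈c = x≢c (x∈⁅y⁆⇒x≡y (cur s) x∈c)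

    nbrMeet-toChild : ∀ {s d c'} → Coherent s d → MeetAt c' (cur s) (time s) →
      ∀ c x → x ∈ override (nbr s) c' ⁅ cur s ⁆ c → Meets c x
    nbrMeet-toChild {s} {c' = c'} coh meet c x x∈ with ∈-override⁻ (nbr s) c' ⁅ cur s ⁆ c x∈
    ... | inj₂ x∈N = nbrMeet coh c x x∈N
    ... | inj₁ (refl , x∈c) rewrite x∈⁅y⁆⇒x≡y (cur s) x∈c = time s , meet

    coherent-visitEnd : ∀ {s d} → Coherent s d →
      Coherent (record s { phase = seeking ; visited = visited s ∪ ⁅ cur s ⁆
                         ; enc = enc s [ cur s ]≔ outside }) d
    coherent-visitEnd coh =
      coherent (pathHome-mono (p⊆p∪q _) (pathHome coh)) (encUnvisited-visitEnd coh) (nbrMeet coh)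

    coherent-toParent : ∀ {s d q} → Coherent s (suc d) → parent s (cur s) ≡ just q →
      q ∈ visited s × Coherent (record s { cur = q }) d
    coherent-toParent coh pq with pathHome coh
    ... | viaParent py qV _ path with just-injective (trans (sym pq) py)
    ...   | refl = qV , coherent path (encUnvisited coh) (nbrMeet coh)

    coherent-advance : ∀ {s d} → Coherent s d → Coherent (advance s) d
    coherent-advance (coherent path encU nbrM) = coherent path encU nbrM

    meetAt-later : ∀ {x y δ t} → MeetAt x y (suc δ + t) → MeetAt x y (δ + suc t)
    meetAt-later {x} {y} {δ} {t} = subst (MeetAt x y) (sym (+-suc δ t))

    spendOne : ∀ {m C} → m + suc C ≤ bound → suc m + C ≤ bound
    spendOne {m} = subst (_≤ bound) (+-suc m _)

    progress : ∀ {s} → Invariant s → ∃ (Step G (suc b) home s)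
    progress (invariant coh pot _) = enabled (pathHome coh) pot refl
      where
      enabled : ∀ {s d ph C S} → PathHome (parent s) (visited s) (cur s) d → Potential s d ph C S →
                 phase s ≡ ph → ∃ (Step G (suc b) home s)
      enabled _ (riding zero _ _ _) eq = _ , visit-end eq
      enabled _ (riding (suc r) _ _ _) eq = _ , visit-ride eq
      enabled {s} _ (childAhead _ _ c₁ _ c₁∈ _ _) eq
        with any? (λ c' → (c' ∈? pending s) ×-dec (π G c' (time s) ≟ π G (cur s) (time s)))
      ... | yes (c' , c'∈ , meet) = _ , to-child c' eq c'∈ meet
      ... | no noneMet = _ , wait-child eq (c₁ , c₁∈) (λ c' c'∈ meet → noneMet (c' , c'∈ , meet))
      enabled (root atHome) (doneAtHome none) eq = _ , halt eq none atHome
      enabled {s} _ (parentAhead _ _ y none py _) eq with cur s ≟ home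
      ... | yes atHome = _ , halt eq none atHome
      ... | no away with π G y (time s) ≟ π G (cur s) (time s)
      ...   | yes meet = _ , to-parent y eq none away py meet
      ...   | no apart = _ , wait-parent y eq none away py apart

    Continues : State k → ℕ → Set
    Continues s' m = Σ (Invariant s') λ i' → measure i' < m

    ride : ∀ {s d r C S} → Coherent s d → Potential s d (visiting (suc r)) C S → moves s + C ≤ bound →
      Continues (record (advance s) { phase = visiting r ; enc = enc s ∪ newlyMet G s
                                    ; nbr = override (nbr s) (cur s) (nbr s (cur s) ∪ newlyMet G s) }) (C + S)
    ride coh (riding _ u cV eqU) budget =
      invariant (coherent (pathHome coh) (encUnvisited-ride coh) (nbrMeet-ride coh))
                (riding _ u cV eqU) (spendOne budget) , ≤-refl

    endVisit : ∀ {s d C S} → Coherent s d → Potential s d (visiting 0) C S → moves s + C ≤ bound →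
      Continues (record s { phase = seeking ; visited = visited s ∪ ⁅ cur s ⁆
                          ; enc = enc s [ cur s ]≔ outside }) (C + S)
    endVisit {s} coh (riding _ u cV eqU) budget
      with seekingPotential (x∈p∪q⁺ (inj₂ (x∈⁅x⁆ (cur s)))) (coherent-visitEnd coh)
         | suc-injective (trans (sym (x∉p⇒∣∁p∣≡1+∣∁[p∪⁅x⁆]∣ (visited s) cV)) eqU)
    ... | _ , _ , pot' , C'≤ , refl | refl =
      invariant (coherent-visitEnd coh) pot' (≤-trans (+-monoʳ-≤ (moves s) C'≤) budget) ,
      +-mono-≤-< C'≤ (n<1+n _)

    switchToChild : ∀ {s d C S} c' → c' ∈ pending s → MeetAt c' (cur s) (time s) →
      Coherent s d → Potential s d seeking C S → moves s + C ≤ bound →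
      Continues (record s { cur = c' ; phase = visiting (suc b) ; parent = override (parent s) c' (just (cur s))
                          ; nbr = override (nbr s) c' ⁅ cur s ⁆ }) (C + S)
    switchToChild {s} c' c'∈ meet coh (childAhead u δ _ cV _ _ eqU) budget =
      invariant (coherent (viaParent (override-≡ (parent s) c' _) cV (time s , meet)
                            (pathHome-override c'∉V (λ { refl → c'∉V cV }) (pathHome coh)))
                          (encUnvisited coh) (nbrMeet-toChild coh meet))
                (riding (suc b) u c'∉V eqU) (≤-trans (+-monoʳ-≤ (moves s) (m≤n+m _ δ)) budget) ,
      +-mono-≤-< (m≤n+m _ δ) (≤-reflexive (rank-eq u _))
      where
      c'∈E = proj₂ (x∈p∩q⁻ (nbr s (cur s)) (enc s) c'∈)
      c'∉V = encUnvisited coh c' c'∈E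
      rank-eq : ∀ u d → suc (suc (4 * u + 2 * suc d)) ≡ 4 * suc u + 2 * d
      rank-eq = solve-∀
    switchToChild c' c'∈ _ _ (doneAtHome none) _ = ⊥-elim (none (c' , c'∈))
    switchToChild c' c'∈ _ _ (parentAhead _ _ _ none _ _) _ = ⊥-elim (none (c' , c'∈))

    waitForChild : ∀ {s d C S} → phase s ≡ seeking → Nonempty (pending s) →
      (∀ c' → c' ∈ pending s → ¬ MeetAt c' (cur s) (time s)) →
      Coherent s d → Potential s d seeking C S → moves s + C ≤ bound → Continues (advance s) (C + S)
    waitForChild _ _ noneMet _ (childAhead _ zero c₁ _ c₁∈ meet _) _ = ⊥-elim (noneMet c₁ c₁∈ meet)
    waitForChild ph _ _ coh (childAhead u (suc δ) c₁ cV c₁∈ meet eqU) budget =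
      invariant (coherent-advance coh) (fromPhase ph (childAhead u δ c₁ cV c₁∈ (meetAt-later meet) eqU))
                (spendOne budget) , ≤-refl
    waitForChild _ someone _ _ (doneAtHome none) _ = ⊥-elim (none someone)
    waitForChild _ someone _ _ (parentAhead _ _ _ none _ _) _ = ⊥-elim (none someone)

    switchToParent : ∀ {s d C S} q → phase s ≡ seeking → Empty (pending s) → cur s ≢ home →
      parent s (cur s) ≡ just q → Coherent s d → Potential s d seeking C S → moves s + C ≤ bound →
      Continues (record s { cur = q }) (C + S)
    switchToParent _ _ none _ _ _ (childAhead _ _ c₁ _ c₁∈ _ _) _ = ⊥-elim (none (c₁ , c₁∈))
    switchToParent _ _ _ away _ coh (doneAtHome _) _ with pathHome coh
    ... | root atHome = ⊥-elim (away atHome)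
    switchToParent {s} q ph _ _ pq coh (parentAhead d δ _ _ _ _) budget with coherent-toParent coh pq
    ... | qV , coh' with seekingPotential qV coh'
    ...   | _ , _ , pot' , C'≤ , refl =
      invariant coh' (fromPhase ph pot') (≤-trans (+-monoʳ-≤ (moves s) C'≤δ) budget) ,
      +-mono-≤-< C'≤δ (+-monoʳ-< (4 * unvisited s) (*-monoʳ-< 2 (n<1+n d)))
      where C'≤δ = ≤-trans C'≤ (m≤n+m _ δ)

    waitForParent : ∀ {s d C S} q → phase s ≡ seeking → Empty (pending s) → cur s ≢ home →
      parent s (cur s) ≡ just q → ¬ MeetAt q (cur s) (time s) →
      Coherent s d → Potential s d seeking C S → moves s + C ≤ bound → Continues (advance s) (C + S)
    waitForParent _ _ none _ _ _ _ (childAhead _ _ c₁ _ c₁∈ _ _) _ = ⊥-elim (none (c₁ , c₁∈))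
    waitForParent _ _ _ away _ _ coh (doneAtHome _) _ with pathHome coh
    ... | root atHome = ⊥-elim (away atHome)
    waitForParent _ _ _ _ pq apart _ (parentAhead _ zero _ _ py meet) _ with just-injective (trans (sym pq) py)
    ... | refl = ⊥-elim (apart meet)
    waitForParent _ ph none _ _ _ coh (parentAhead d (suc δ) y _ py meet) budget =
      invariant (coherent-advance coh) (fromPhase ph (parentAhead d δ y none py (meetAt-later meet)))
                (spendOne budget) , ≤-refl

    preserve : ∀ {s s'} (i : Invariant s) → Step G (suc b) home s s' →
               HaltedWithin bound s' ⊎ Continues s' (measure i)
    preserve (invariant _ _ budget) (halt _ _ _) = inj₁ (refl , m+n≤o⇒m≤o _ budget)
    preserve (invariant coh pot budget) (visit-ride eq) = inj₂ (ride coh (toPhase eq pot) budget)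
    preserve (invariant coh pot budget) (visit-end eq) = inj₂ (endVisit coh (toPhase eq pot) budget)
    preserve (invariant coh pot budget) (to-child c' ph c'∈ meet) =
      inj₂ (switchToChild c' c'∈ meet coh (toPhase ph pot) budget)
    preserve (invariant coh pot budget) (wait-child ph someone noneMet) =
      inj₂ (waitForChild ph someone noneMet coh (toPhase ph pot) budget)
    preserve (invariant coh pot budget) (to-parent q ph none away pq _) =
      inj₂ (switchToParent q ph none away pq coh (toPhase ph pot) budget)
    preserve (invariant coh pot budget) (wait-parent q ph none away pq apart) =
      inj₂ (waitForParent q ph none away pq apart coh (toPhase ph pot) budget)

    notHalted : ∀ {s} → Invariant s → phase s ≢ halted
    notHalted (invariant _ pot _) eq with toPhase eq pot
    ... | ()

    initialCredit≤ : ∀ k' → suc b + perCarrier * k' + b * 0 ≤ (3 * suc k' ∸ 2) * suc b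
    initialCredit≤ k' = ≤-trans (m≤m+n _ (2 * k'))
      (≤-reflexive (trans (sum-eq b k') (cong (λ m → (m ∸ 2) * suc b) (sym (triple-eq k')))))
      where
      sum-eq : ∀ b k' → suc b + suc (3 * b) * k' + b * 0 + 2 * k' ≡ suc (3 * k') * suc b
      sum-eq = solve-∀
      triple-eq : ∀ k' → 3 * suc k' ≡ 2 + suc (3 * k')
      triple-eq = solve-∀

    initialInvariant : Invariant (initial (suc b) home)
    initialInvariant = invariant (coherent (root refl) (λ _ _ → ∉⊥) (λ _ _ x∈∅ → ⊥-elim (∉⊥ x∈∅)))
      (riding (suc b) (pred k) ∉⊥ (trans (∣∁⊥∣≡n k) (sym k≡1+k')))
      (subst (λ m → suc b + perCarrier * pred k + b * 0 ≤ (3 * m ∸ 2) * suc b) k≡1+k' (initialCredit≤ (pred k)))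
      where
      instance _ = nonZeroIndex home
      k≡1+k' : suc (pred k) ≡ k
      k≡1+k' = suc-pred k

  hitchARide-haltsWithin : ∀ {B′} → RecurringMeetings B′ → ∀ home →
                           HaltsWithin G B′ home ((3 * k ∸ 2) * B′) (initial B′ home)
  hitchARide-haltsWithin {zero} recur home with recur home home (0 , refl) 0
  ... | _ , () , _
  hitchARide-haltsWithin {suc b} recur home =
    haltsWithin-byMeasure Invariant measure notHalted
      progress preserve initialInvariant
    where open HitchARide b recur home

theorem10 : ∀ {n k} (G : PVGraph n k) → Feasible G →
    (B : ℕ) → systemPeriod G ≤ B →
    (knownHomogeneous : Bool) → (knownHomogeneous ≡ true → Homogeneous G) →
    (c₀ : Fin k) →
    HaltsWithin G (B′ knownHomogeneous B) c₀ ((3 * k ∸ 2) * B′ knownHomogeneous B)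
      (initial (B′ knownHomogeneous B) c₀)
theorem10 G _ B p≤B kh hom c₀ = hitchARide-haltsWithin G (recurringMeetings-B′ G B kh p≤B hom) c₀
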